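{- Let $n \ge 3$, let $w_0 = n(n-1)\cdots 21 \in \mathfrak{S}_n$ be the longest element, and let $k \in [1,n-1]$. Then $$\min\nolimits_k(w_0) = \min\{k,n-k\} \quad\text{and}\quad \max\nolimits_k(w_0) \le k(n-k).$$
   Context: $\mathfrak{S}_n$ is the symmetric group on $[1,n]$ (one-line notation); $\sigma_i$ is the simple reflection exchanging $i$ and $i+1$. For $w\in\mathfrak{S}_n$, $\min_k(w)$ and $\max_k(w)$ are the minimum and maximum, over all reduced decompositions (minimal-length expressions as products of simple reflections) of $w$, of the number of occurrences of the factor $\sigma_k$. -}

module Defs where

open import Data.Nat using (ℕ; zero; suc; _≤_; _<_; _∸_; _≟_)
open import Data.List using (List; []; _∷_; foldl; reverse; length)
open import Data.List.Relation.Unary.All using (All)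
open import Data.Product using (Σ; _×_)
open import Relation.Binary.PropositionalEquality using (_≡_)
open import Relation.Nullary using (yes; no)

-- Permutations of [1,n] in one-line notation, as the list [w(1), …, w(n)].

upFrom : ℕ → ℕ → List ℕ
upFrom a zero = []
upFrom a (suc m) = a ∷ upFrom (suc a) m

idPerm : ℕ → List ℕ
idPerm n = upFrom 1 n

longest : ℕ → List ℕ
longest n = reverse (idPerm n)

swapPos : ℕ → List ℕ → List ℕ
swapPos zero (a ∷ b ∷ xs) = b ∷ a ∷ xs
swapPos (suc j) (x ∷ xs) = x ∷ swapPos j xs
swapPos _ xs = xs

-- right multiplication by the simple reflection σ_i (i ∈ [1,n-1]):
-- (w σ_i)(j) = w(σ_i(j)), i.e. swap positions i and i+1 of the one-line notation
mulσ : List ℕ → ℕ → List ℕ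
mulσ w i = swapPos (i ∸ 1) w

IsWord : ℕ → List ℕ → Set
IsWord n s = All (λ i → 1 ≤ i × i < n) s

eval : ℕ → List ℕ → List ℕ
eval n s = foldl mulσ (idPerm n) s

IsReduced : ℕ → List ℕ → List ℕ → Set
IsReduced n w s =
  IsWord n s × eval n s ≡ w ×
  ((t : List ℕ) → IsWord n t → eval n t ≡ w → length s ≤ length t)

occ : ℕ → List ℕ → ℕ
occ k [] = zero
occ k (i ∷ s) with i ≟ k
... | yes _ = suc (occ k s)
... | no _ = occ k s

IsMinK : ℕ → ℕ → List ℕ → ℕ → Set
IsMinK n k w m =
  Σ (List ℕ) (λ s → IsReduced n w s × occ k s ≡ m) ×
  ((s : List ℕ) → IsReduced n w s → m ≤ occ k s)

MaxKAtMost : ℕ → ℕ → List ℕ → ℕ → Set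
MaxKAtMost n k w b = (s : List ℕ) → IsReduced n w s → occ k s ≤ b

module Submission where

-- Right multiplication by σ_i swaps the entries in positions i, i+1.
-- This raises the inversion number inv by at most one, and not at all unless the
-- two entries form an ascent.  Since inv(id) = 0 and inv(w₀) = n(n−1)/2, a word for
-- w₀ has at least n(n−1)/2 letters plus one per letter not swapping an ascent.  The
-- explicit words L (σ_k occurs k times) and R (σ_k occurs n−k times) for w₀ have
-- length n(n−1)/2, so they are reduced and along every reduced word of w₀ each
-- letter swaps an ascent.
--
-- For a weight g let P(u) = g(u₁) + ⋯ + g(u_k); only σ_k
-- changes P.  For g = id, σ_k swapping an ascent raises P, and P(w₀) − P(id) =
-- k(n−k): this bounds max_k.  For g the indicator of [1,k], σ_k changes P by at
-- most one, P(id) = k and P(w₀) = k ∸ (n−k): so every word for w₀ contains σ_k at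
-- least min(k, n−k) times, and L or R attains this.

open import Defs
open import Data.Nat using (ℕ; zero; suc; _+_; _*_; _∸_; _⊓_; _≤_; _<_; z≤n; s≤s; _≟_; _≤?_)
open import Data.Nat.Properties
open import Data.Nat.ListAction using (sum)
open import Data.Nat.ListAction.Properties using (sum-↭)
open import Data.Nat.Tactic.RingSolver using (solve-∀)
open import Algebra.Properties.CommutativeSemigroup +-commutativeSemigroup using (x∙yz≈y∙xz)
open import Data.List using (List; []; _∷_; _++_; _∷ʳ_; foldl; reverse; length; map; take)
open import Data.List.Properties
  using (foldl-++; map-++; map-id; length-++; length-map; length-reverse; unfold-reverse; reverse-++; reverse-involutive)
open import Data.List.Relation.Unary.All as All using (All; []; _∷_)
open import Data.List.Relation.Unary.All.Properties using (++⁺; map⁺)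
open import Data.List.Relation.Binary.Permutation.Propositional.Properties using (↭-reverse)
open import Data.Product using (Σ; _×_; _,_; proj₁; proj₂)
open import Data.Empty using (⊥-elim)
open import Function using (id)
open import Relation.Binary.PropositionalEquality
open import Relation.Nullary using (yes; no; ¬_)

⟦_<_⟧ : ℕ → ℕ → ℕ
⟦ _ < zero ⟧ = 0
⟦ zero < suc _ ⟧ = 1
⟦ suc a < suc b ⟧ = ⟦ a < b ⟧

⟦<⟧≤1 : ∀ a b → ⟦ a < b ⟧ ≤ 1
⟦<⟧≤1 _ zero = z≤n
⟦<⟧≤1 zero (suc b) = s≤s z≤n
⟦<⟧≤1 (suc a) (suc b) = ⟦<⟧≤1 a b

⟦<⟧-asym : ∀ a b → ⟦ a < b ⟧ ≡ 1 → ⟦ b < a ⟧ ≡ 0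
⟦<⟧-asym zero _ _ = refl
⟦<⟧-asym (suc a) zero ()
⟦<⟧-asym (suc a) (suc b) e = ⟦<⟧-asym a b e

⟦<⟧-true : ∀ {a b} → a < b → ⟦ a < b ⟧ ≡ 1
⟦<⟧-true {zero} {suc b} _ = refl
⟦<⟧-true {suc a} {suc b} (s≤s h) = ⟦<⟧-true h

⟦<⟧-false : ∀ {a b} → b ≤ a → ⟦ a < b ⟧ ≡ 0
⟦<⟧-false {b = zero} _ = refl
⟦<⟧-false {suc a} {suc b} (s≤s h) = ⟦<⟧-false h

nonAscent : ℕ → ℕ → ℕ
nonAscent a b = 1 ∸ ⟦ a < b ⟧

nonAscent≡0⇒< : ∀ a b → nonAscent a b ≡ 0 → a < b
nonAscent≡0⇒< _ zero ()
nonAscent≡0⇒< zero (suc b) _ = s≤s z≤n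
nonAscent≡0⇒< (suc a) (suc b) e = s≤s (nonAscent≡0⇒< a b e)

-- The entries in (0-indexed) positions j and j+1 of a list, i.e. the entries
-- exchanged by swapPos j; both are 0 when the list is too short to swap.
leftOf : ℕ → List ℕ → ℕ
leftOf zero (a ∷ _ ∷ _) = a
leftOf (suc j) (_ ∷ xs) = leftOf j xs
leftOf _ _ = 0

rightOf : ℕ → List ℕ → ℕ
rightOf zero (_ ∷ b ∷ _) = b
rightOf (suc j) (_ ∷ xs) = rightOf j xs
rightOf _ _ = 0

smaller : ℕ → List ℕ → ℕ
smaller x [] = 0
smaller x (y ∷ ys) = ⟦ y < x ⟧ + smaller x ys

inv : List ℕ → ℕ
inv [] = 0
inv (x ∷ xs) = smaller x xs + inv xs

smaller-swap : ∀ x j w → smaller x (swapPos j w) ≡ smaller x w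
smaller-swap x zero (a ∷ b ∷ xs) = x∙yz≈y∙xz ⟦ b < x ⟧ ⟦ a < x ⟧ (smaller x xs)
smaller-swap x zero (_ ∷ []) = refl
smaller-swap x zero [] = refl
smaller-swap x (suc j) [] = refl
smaller-swap x (suc j) (y ∷ ys) = cong (⟦ y < x ⟧ +_) (smaller-swap x j ys)

-- Swapping adjacent entries a, b removes the inversion (a, b) if a > b and
-- creates the inversion (b, a) if a < b; all other pairs are unaffected.
inv-swap : ∀ j w → inv (swapPos j w) + ⟦ rightOf j w < leftOf j w ⟧ ≡ inv w + ⟦ leftOf j w < rightOf j w ⟧
inv-swap zero (a ∷ b ∷ xs) = rearrange ⟦ a < b ⟧ ⟦ b < a ⟧ (smaller b xs) (smaller a xs) (inv xs)
  where
    rearrange : ∀ (p q r s t : ℕ) → (p + r) + (s + t) + q ≡ (q + s) + (r + t) + p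
    rearrange = solve-∀
inv-swap zero (_ ∷ []) = refl
inv-swap zero [] = refl
inv-swap (suc j) [] = refl
inv-swap (suc j) (x ∷ xs) = begin
    smaller x (swapPos j xs) + inv (swapPos j xs) + ⟦ b < a ⟧
  ≡⟨ cong (λ z → z + inv (swapPos j xs) + ⟦ b < a ⟧) (smaller-swap x j xs) ⟩
    smaller x xs + inv (swapPos j xs) + ⟦ b < a ⟧
  ≡⟨ +-assoc (smaller x xs) _ _ ⟩
    smaller x xs + (inv (swapPos j xs) + ⟦ b < a ⟧)
  ≡⟨ cong (smaller x xs +_) (inv-swap j xs) ⟩
    smaller x xs + (inv xs + ⟦ a < b ⟧)
  ≡⟨ +-assoc (smaller x xs) _ _ ⟨
    smaller x xs + inv xs + ⟦ a < b ⟧ ∎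
  where
    open ≡-Reasoning
    a = leftOf j xs
    b = rightOf j xs

indicator-trade : ∀ i' i p q → i' + q ≡ i + p → (p ≡ 1 → q ≡ 0) → p ≤ 1 → i' + (1 ∸ p) ≤ suc i
indicator-trade i' i zero q e _ _ = begin
    i' + 1 ≡⟨ +-comm i' 1 ⟩
    suc i' ≤⟨ s≤s (≤-trans (m≤m+n i' q) (≤-reflexive (trans e (+-identityʳ i)))) ⟩
    suc i ∎
  where open ≤-Reasoning
indicator-trade i' i (suc zero) q e q≡0 _ rewrite q≡0 refl = ≤-reflexive (trans e (+-comm i 1))
indicator-trade i' i (suc (suc p)) q e _ (s≤s ())

inv-swap-bound : ∀ j w → inv (swapPos j w) + nonAscent (leftOf j w) (rightOf j w) ≤ suc (inv w)
inv-swap-bound j w =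
  indicator-trade _ _ _ _ (inv-swap j w) (⟦<⟧-asym (leftOf j w) (rightOf j w)) (⟦<⟧≤1 (leftOf j w) (rightOf j w))

nonAscents : List ℕ → List ℕ → ℕ
nonAscents u [] = 0
nonAscents u (i ∷ s) = nonAscent (leftOf (i ∸ 1) u) (rightOf (i ∸ 1) u) + nonAscents (mulσ u i) s

inv-foldl : ∀ u s → inv (foldl mulσ u s) + nonAscents u s ≤ inv u + length s
inv-foldl u [] = ≤-refl
inv-foldl u (i ∷ s) = begin
    inv F + (na + nonAscents u' s)   ≡⟨ x∙yz≈y∙xz (inv F) na _ ⟩
    na + (inv F + nonAscents u' s)   ≤⟨ +-monoʳ-≤ na (inv-foldl u' s) ⟩
    na + (inv u' + length s)         ≡⟨ x∙yz≈y∙xz na (inv u') (length s) ⟩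
    inv u' + (na + length s)         ≡⟨ +-assoc (inv u') na (length s) ⟨
    inv u' + na + length s           ≤⟨ +-monoˡ-≤ (length s) (inv-swap-bound (i ∸ 1) u) ⟩
    suc (inv u) + length s           ≡⟨ +-suc (inv u) (length s) ⟨
    inv u + suc (length s) ∎
  where
    open ≤-Reasoning
    u' = mulσ u i
    F = foldl mulσ u' s
    na = nonAscent (leftOf (i ∸ 1) u) (rightOf (i ∸ 1) u)

prefix : (ℕ → ℕ) → ℕ → List ℕ → ℕ
prefix g m w = sum (map g (take m w))

prefix-swapAt : ∀ g j w → prefix g (suc j) (swapPos j w) + g (leftOf j w) ≡ prefix g (suc j) w + g (rightOf j w)
prefix-swapAt g zero (a ∷ b ∷ _) = exchange (g a) (g b)
  where
    exchange : ∀ (p q : ℕ) → q + 0 + p ≡ p + 0 + q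
    exchange = solve-∀
prefix-swapAt g zero (_ ∷ []) = refl
prefix-swapAt g zero [] = refl
prefix-swapAt g (suc j) [] = refl
prefix-swapAt g (suc j) (x ∷ xs) = begin
    g x + prefix g (suc j) (swapPos j xs) + g (leftOf j xs)
  ≡⟨ +-assoc (g x) _ _ ⟩
    g x + (prefix g (suc j) (swapPos j xs) + g (leftOf j xs))
  ≡⟨ cong (g x +_) (prefix-swapAt g j xs) ⟩
    g x + (prefix g (suc j) xs + g (rightOf j xs))
  ≡⟨ +-assoc (g x) _ _ ⟨
    g x + prefix g (suc j) xs + g (rightOf j xs) ∎
  where open ≡-Reasoning

-- Any other swap permutes the prefix of length m or leaves it alone.
prefix-swapElsewhere : ∀ g m j w → ¬ (suc j ≡ m) → prefix g m (swapPos j w) ≡ prefix g m w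
prefix-swapElsewhere g zero zero (_ ∷ _ ∷ _) _ = refl
prefix-swapElsewhere g (suc zero) zero (_ ∷ _ ∷ _) j≢m = ⊥-elim (j≢m refl)
prefix-swapElsewhere g (suc (suc m)) zero (a ∷ b ∷ _) _ = x∙yz≈y∙xz (g b) (g a) _
prefix-swapElsewhere g m zero (_ ∷ []) _ = refl
prefix-swapElsewhere g m zero [] _ = refl
prefix-swapElsewhere g m (suc j) [] _ = refl
prefix-swapElsewhere g zero (suc j) (_ ∷ _) _ = refl
prefix-swapElsewhere g (suc m) (suc j) (x ∷ xs) j≢m =
  cong (g x +_) (prefix-swapElsewhere g m j xs (λ e → j≢m (cong suc e)))

prefix-ascending : ∀ k u s → All (1 ≤_) s → nonAscents u s ≡ 0 →
  prefix id (suc k) u + occ (suc k) s ≤ prefix id (suc k) (foldl mulσ u s)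
prefix-ascending k u [] _ _ = ≤-reflexive (+-identityʳ _)
prefix-ascending k u (suc i ∷ s) (s≤s z≤n ∷ ps) e with suc i ≟ suc k
... | yes refl = begin
    P u + suc (occ (suc k) s) ≡⟨ +-suc (P u) _ ⟩
    suc (P u) + occ (suc k) s ≤⟨ +-monoˡ-≤ (occ (suc k) s) raises ⟩
    P u' + occ (suc k) s      ≤⟨ prefix-ascending k u' s ps (m+n≡0⇒n≡0 na e) ⟩
    P (foldl mulσ u' s) ∎
  where
    open ≤-Reasoning
    P = prefix id (suc i)
    u' = mulσ u (suc i)
    na = nonAscent (leftOf i u) (rightOf i u)
    raises : suc (P u) ≤ P u'
    raises = +-cancelʳ-≤ (leftOf i u) (suc (P u)) (P u') (begin
      suc (P u) + leftOf i u  ≡⟨ +-suc (P u) (leftOf i u) ⟨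
      P u + suc (leftOf i u)  ≤⟨ +-monoʳ-≤ (P u) (nonAscent≡0⇒< _ _ (m+n≡0⇒m≡0 na e)) ⟩
      P u + rightOf i u       ≡⟨ prefix-swapAt id i u ⟨
      P u' + leftOf i u ∎)
... | no i≢k = begin
    prefix id (suc k) u + occ (suc k) s
      ≡⟨ cong (_+ occ (suc k) s) (prefix-swapElsewhere id (suc k) i u i≢k) ⟨
    prefix id (suc k) (mulσ u (suc i)) + occ (suc k) s
      ≤⟨ prefix-ascending k (mulσ u (suc i)) s ps (m+n≡0⇒n≡0 (nonAscent (leftOf i u) (rightOf i u)) e) ⟩
    prefix id (suc k) (foldl mulσ (mulσ u (suc i)) s) ∎
  where open ≤-Reasoning

prefix-occ-bound : ∀ g → (∀ x → g x ≤ 1) → ∀ k u s → All (1 ≤_) s →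
  prefix g (suc k) u ≤ prefix g (suc k) (foldl mulσ u s) + occ (suc k) s
prefix-occ-bound g g≤1 k u [] _ = m≤m+n _ 0
prefix-occ-bound g g≤1 k u (suc i ∷ s) (s≤s z≤n ∷ ps) with suc i ≟ suc k
... | yes refl = begin
    P u                             ≤⟨ m≤m+n (P u) _ ⟩
    P u + g (rightOf i u)           ≡⟨ prefix-swapAt g i u ⟨
    P u' + g (leftOf i u)           ≤⟨ +-monoʳ-≤ (P u') (g≤1 _) ⟩
    P u' + 1                        ≤⟨ +-monoˡ-≤ 1 (prefix-occ-bound g g≤1 k u' s ps) ⟩
    P F + occ (suc k) s + 1         ≡⟨ +-assoc (P F) _ 1 ⟩
    P F + (occ (suc k) s + 1)       ≡⟨ cong (P F +_) (+-comm _ 1) ⟩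
    P F + suc (occ (suc k) s) ∎
  where
    open ≤-Reasoning
    P = prefix g (suc i)
    u' = mulσ u (suc i)
    F = foldl mulσ u' s
... | no i≢k = begin
    prefix g (suc k) u                  ≡⟨ prefix-swapElsewhere g (suc k) i u i≢k ⟨
    prefix g (suc k) (mulσ u (suc i))   ≤⟨ prefix-occ-bound g g≤1 k (mulσ u (suc i)) s ps ⟩
    prefix g (suc k) (foldl mulσ (mulσ u (suc i)) s) + occ (suc k) s ∎
  where open ≤-Reasoning

countdown : ℕ → List ℕ
countdown zero = []
countdown (suc m) = suc m ∷ countdown m

-- triangle m = 0 + 1 + ⋯ + (m−1) = m(m−1)/2, the length of w₀ in 𝔖_m.
triangle : ℕ → ℕ
triangle zero = 0
triangle (suc m) = m + triangle m

upFrom-∷ʳ : ∀ a m → upFrom a (suc m) ≡ upFrom a m ∷ʳ (a + m)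
upFrom-∷ʳ a zero = cong (_∷ []) (sym (+-identityʳ a))
upFrom-∷ʳ a (suc m) = cong (a ∷_) (trans (upFrom-∷ʳ (suc a) m) (cong (upFrom (suc a) m ∷ʳ_) (sym (+-suc a m))))

longest≡countdown : ∀ m → longest m ≡ countdown m
longest≡countdown zero = refl
longest≡countdown (suc m) = begin
    reverse (upFrom 1 (suc m))      ≡⟨ cong reverse (upFrom-∷ʳ 1 m) ⟩
    reverse (upFrom 1 m ∷ʳ suc m)   ≡⟨ reverse-++ (upFrom 1 m) (suc m ∷ []) ⟩
    suc m ∷ reverse (upFrom 1 m)    ≡⟨ cong (suc m ∷_) (longest≡countdown m) ⟩
    countdown (suc m) ∎
  where open ≡-Reasoning

longest-split : ∀ n k → k ≤ n → longest n ≡ countdown (k + (n ∸ k))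
longest-split n k k≤n = trans (longest≡countdown n) (cong countdown (sym (m+[n∸m]≡n k≤n)))

length-upFrom : ∀ a m → length (upFrom a m) ≡ m
length-upFrom a zero = refl
length-upFrom a (suc m) = cong suc (length-upFrom (suc a) m)

length-countdown : ∀ m → length (countdown m) ≡ m
length-countdown zero = refl
length-countdown (suc m) = cong suc (length-countdown m)

smaller-upFrom : ∀ x b m → x ≤ b → smaller x (upFrom b m) ≡ 0
smaller-upFrom x b zero _ = refl
smaller-upFrom x b (suc m) x≤b = cong₂ _+_ (⟦<⟧-false x≤b) (smaller-upFrom x (suc b) m (m≤n⇒m≤1+n x≤b))

inv-upFrom : ∀ a m → inv (upFrom a m) ≡ 0
inv-upFrom a zero = refl
inv-upFrom a (suc m) = cong₂ _+_ (smaller-upFrom a (suc a) m (n≤1+n a)) (inv-upFrom (suc a) m)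

smaller-countdown : ∀ x m → m < x → smaller x (countdown m) ≡ m
smaller-countdown x zero _ = refl
smaller-countdown x (suc m) m<x = cong₂ _+_ (⟦<⟧-true m<x) (smaller-countdown x m (<⇒≤ m<x))

inv-countdown : ∀ m → inv (countdown m) ≡ triangle m
inv-countdown zero = refl
inv-countdown (suc m) = cong₂ _+_ (smaller-countdown (suc m) m ≤-refl) (inv-countdown m)

take-upFrom : ∀ a k m → k ≤ m → take k (upFrom a m) ≡ upFrom a k
take-upFrom a zero m _ = refl
take-upFrom a (suc k) (suc m) (s≤s k≤m) = cong (a ∷_) (take-upFrom (suc a) k m k≤m)

take-countdown : ∀ k d → take k (countdown (k + d)) ≡ map (_+ d) (countdown k)
take-countdown zero d = refl
take-countdown (suc k) d = cong (suc (k + d) ∷_) (take-countdown k d)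

sum-map-+ : ∀ d xs → sum (map (_+ d) xs) ≡ sum xs + length xs * d
sum-map-+ d [] = refl
sum-map-+ d (x ∷ xs) = trans (cong ((x + d) +_) (sum-map-+ d xs)) (regroup x d (sum xs) (length xs))
  where
    regroup : ∀ (x d s l : ℕ) → x + d + (s + l * d) ≡ x + s + (d + l * d)
    regroup = solve-∀

-- The witness words, written with 0-indexed letters (letter j stands for σ_{j+1}).
-- cycleLeft m = σ₁σ₂⋯σ_m moves the first entry behind the next m entries.
cycleLeft : ℕ → List ℕ
cycleLeft zero = []
cycleLeft (suc m) = 0 ∷ map suc (cycleLeft m)

-- cycleRight m = σ_m⋯σ₂σ₁ moves the entry in position m+1 to the front.
cycleRight : ℕ → List ℕ
cycleRight zero = []
cycleRight (suc m) = map suc (cycleRight m) ++ (0 ∷ [])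

-- reverserL (m+1) reverses the last m entries, then moves the first entry to the end.
reverserL : ℕ → List ℕ
reverserL zero = []
reverserL (suc m) = map suc (reverserL m) ++ cycleLeft m

-- reverserR (m+1) reverses the first m entries, then moves the last entry to the front.
reverserR : ℕ → List ℕ
reverserR zero = []
reverserR (suc m) = reverserR m ++ cycleRight m

act-shift : ∀ y w s → foldl mulσ (y ∷ w) (map suc (map suc s)) ≡ y ∷ foldl mulσ w (map suc s)
act-shift y w [] = refl
act-shift y w (j ∷ s) = act-shift y (swapPos j w) s

act-cycleLeft : ∀ x ys → foldl mulσ (x ∷ ys) (map suc (cycleLeft (length ys))) ≡ ys ∷ʳ x
act-cycleLeft x [] = refl
act-cycleLeft x (y ∷ ys) = trans (act-shift y (x ∷ ys) (cycleLeft (length ys))) (cong (y ∷_) (act-cycleLeft x ys))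

act-cycleRight : ∀ x ys → foldl mulσ (ys ∷ʳ x) (map suc (cycleRight (length ys))) ≡ x ∷ ys
act-cycleRight x [] = refl
act-cycleRight x (y ∷ ys) = begin
    foldl mulσ (y ∷ (ys ∷ʳ x)) (map suc (map suc c ++ 0 ∷ []))
  ≡⟨ cong (foldl mulσ (y ∷ (ys ∷ʳ x))) (map-++ suc (map suc c) (0 ∷ [])) ⟩
    foldl mulσ (y ∷ (ys ∷ʳ x)) (map suc (map suc c) ++ 1 ∷ [])
  ≡⟨ foldl-++ mulσ (y ∷ (ys ∷ʳ x)) (map suc (map suc c)) (1 ∷ []) ⟩
    mulσ (foldl mulσ (y ∷ (ys ∷ʳ x)) (map suc (map suc c))) 1
  ≡⟨ cong (λ z → mulσ z 1) (trans (act-shift y (ys ∷ʳ x) c) (cong (y ∷_) (act-cycleRight x ys))) ⟩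
    x ∷ y ∷ ys ∎
  where
    open ≡-Reasoning
    c = cycleRight (length ys)

act-reverserL : ∀ xs → foldl mulσ xs (map suc (reverserL (length xs))) ≡ reverse xs
act-reverserL [] = refl
act-reverserL (x ∷ xs) = begin
    foldl mulσ (x ∷ xs) (map suc (map suc (reverserL m) ++ cycleLeft m))
  ≡⟨ cong (foldl mulσ (x ∷ xs)) (map-++ suc (map suc (reverserL m)) (cycleLeft m)) ⟩
    foldl mulσ (x ∷ xs) (map suc (map suc (reverserL m)) ++ map suc (cycleLeft m))
  ≡⟨ foldl-++ mulσ (x ∷ xs) (map suc (map suc (reverserL m))) (map suc (cycleLeft m)) ⟩
    foldl mulσ (foldl mulσ (x ∷ xs) (map suc (map suc (reverserL m)))) (map suc (cycleLeft m))
  ≡⟨ cong (λ z → foldl mulσ z (map suc (cycleLeft m))) (trans (act-shift x xs (reverserL m)) (cong (x ∷_) (act-reverserL xs))) ⟩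
    foldl mulσ (x ∷ reverse xs) (map suc (cycleLeft m))
  ≡⟨ cong (λ z → foldl mulσ (x ∷ reverse xs) (map suc (cycleLeft z))) (length-reverse xs) ⟨
    foldl mulσ (x ∷ reverse xs) (map suc (cycleLeft (length (reverse xs))))
  ≡⟨ act-cycleLeft x (reverse xs) ⟩
    reverse xs ∷ʳ x
  ≡⟨ unfold-reverse x xs ⟨
    reverse (x ∷ xs) ∎
  where
    open ≡-Reasoning
    m = length xs

swap-prefix : ∀ j (xs ys : List ℕ) → suc j < length xs → swapPos j (xs ++ ys) ≡ swapPos j xs ++ ys
swap-prefix zero (_ ∷ _ ∷ _) ys _ = refl
swap-prefix zero (_ ∷ []) ys (s≤s ())
swap-prefix (suc j) (x ∷ xs) ys (s≤s j<∣xs∣) = cong (x ∷_) (swap-prefix j xs ys j<∣xs∣)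

length-swap : ∀ j xs → length (swapPos j xs) ≡ length xs
length-swap zero (_ ∷ _ ∷ _) = refl
length-swap zero (_ ∷ []) = refl
length-swap zero [] = refl
length-swap (suc j) [] = refl
length-swap (suc j) (_ ∷ xs) = cong suc (length-swap j xs)

act-prefix : ∀ xs ys s → All (λ j → suc j < length xs) s →
  foldl mulσ (xs ++ ys) (map suc s) ≡ foldl mulσ xs (map suc s) ++ ys
act-prefix xs ys [] _ = refl
act-prefix xs ys (j ∷ s) (j<∣xs∣ ∷ ps) = begin
    foldl mulσ (swapPos j (xs ++ ys)) (map suc s)   ≡⟨ cong (λ v → foldl mulσ v (map suc s)) (swap-prefix j xs ys j<∣xs∣) ⟩
    foldl mulσ (swapPos j xs ++ ys) (map suc s)     ≡⟨ act-prefix (swapPos j xs) ys s ps' ⟩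
    foldl mulσ (swapPos j xs) (map suc s) ++ ys ∎
  where
    open ≡-Reasoning
    ps' : All (λ i → suc i < length (swapPos j xs)) s
    ps' = subst (λ l → All (λ i → suc i < l) s) (sym (length-swap j xs)) ps

cycleLeft-bound : ∀ m → All (_< m) (cycleLeft m)
cycleLeft-bound zero = []
cycleLeft-bound (suc m) = s≤s z≤n ∷ map⁺ (All.map s≤s (cycleLeft-bound m))

cycleRight-bound : ∀ m → All (_< m) (cycleRight m)
cycleRight-bound zero = []
cycleRight-bound (suc m) = ++⁺ (map⁺ (All.map s≤s (cycleRight-bound m))) (s≤s z≤n ∷ [])

reverserL-bound : ∀ m → All (λ j → suc j < m) (reverserL m)
reverserL-bound zero = []
reverserL-bound (suc m) = ++⁺ (map⁺ (All.map s≤s (reverserL-bound m))) (All.map s≤s (cycleLeft-bound m))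

reverserR-bound : ∀ m → All (λ j → suc j < m) (reverserR m)
reverserR-bound zero = []
reverserR-bound (suc m) = ++⁺ (All.map m<n⇒m<1+n (reverserR-bound m)) (All.map s≤s (cycleRight-bound m))

-- Stated on reverse xs so that the induction runs over xs from the front.
act-reverserR : ∀ xs → foldl mulσ (reverse xs) (map suc (reverserR (length xs))) ≡ xs
act-reverserR [] = refl
act-reverserR (x ∷ xs) = begin
    foldl mulσ (reverse (x ∷ xs)) (map suc (reverserR m ++ cycleRight m))
  ≡⟨ cong₂ (foldl mulσ) (unfold-reverse x xs) (map-++ suc (reverserR m) (cycleRight m)) ⟩
    foldl mulσ (reverse xs ∷ʳ x) (map suc (reverserR m) ++ map suc (cycleRight m))
  ≡⟨ foldl-++ mulσ (reverse xs ∷ʳ x) (map suc (reverserR m)) (map suc (cycleRight m)) ⟩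
    foldl mulσ (foldl mulσ (reverse xs ∷ʳ x) (map suc (reverserR m))) (map suc (cycleRight m))
  ≡⟨ cong (λ z → foldl mulσ z (map suc (cycleRight m))) (trans
       (act-prefix (reverse xs) (x ∷ []) (reverserR m)
         (subst (λ l → All (λ j → suc j < l) (reverserR m)) (sym (length-reverse xs)) (reverserR-bound m)))
       (cong (_∷ʳ x) (act-reverserR xs))) ⟩
    foldl mulσ (xs ∷ʳ x) (map suc (cycleRight m))
  ≡⟨ act-cycleRight x xs ⟩
    x ∷ xs ∎
  where
    open ≡-Reasoning
    m = length xs

occ-++ : ∀ k xs ys → occ k (xs ++ ys) ≡ occ k xs + occ k ys
occ-++ k [] ys = refl
occ-++ k (i ∷ xs) ys with i ≟ k
... | yes _ = cong suc (occ-++ k xs ys)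
... | no _ = occ-++ k xs ys

occ-map-suc : ∀ k s → occ (suc k) (map suc s) ≡ occ k s
occ-map-suc k [] = refl
occ-map-suc k (j ∷ s) with suc j ≟ suc k | j ≟ k
... | yes _ | yes _ = cong suc (occ-map-suc k s)
... | no _ | no _ = occ-map-suc k s
... | yes e | no j≢k = ⊥-elim (j≢k (suc-injective e))
... | no j≢k | yes e = ⊥-elim (j≢k (cong suc e))

occ-zero-map-suc : ∀ s → occ 0 (map suc s) ≡ 0
occ-zero-map-suc [] = refl
occ-zero-map-suc (j ∷ s) = occ-zero-map-suc s

occ-cycleLeft : ∀ k m → k < m → occ k (cycleLeft m) ≡ 1
occ-cycleLeft zero (suc m) _ = cong suc (occ-zero-map-suc (cycleLeft m))
occ-cycleLeft (suc k) (suc m) (s≤s k<m) = trans (occ-map-suc k (cycleLeft m)) (occ-cycleLeft k m k<m)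

occ-cycleRight : ∀ k m → occ k (cycleRight m) ≡ ⟦ k < m ⟧
occ-cycleRight k zero = refl
occ-cycleRight zero (suc m) =
  trans (occ-++ 0 (map suc (cycleRight m)) (0 ∷ [])) (cong (_+ 1) (occ-zero-map-suc (cycleRight m)))
occ-cycleRight (suc k) (suc m) =
  trans (occ-++ (suc k) (map suc (cycleRight m)) (0 ∷ []))
        (trans (+-identityʳ _) (trans (occ-map-suc k (cycleRight m)) (occ-cycleRight k m)))

occ-reverserL : ∀ k m → suc k < m → occ k (reverserL m) ≡ suc k
occ-reverserL zero (suc m) (s≤s k<m) =
  trans (occ-++ 0 (map suc (reverserL m)) (cycleLeft m))
        (cong₂ _+_ (occ-zero-map-suc (reverserL m)) (occ-cycleLeft 0 m k<m))
occ-reverserL (suc k) (suc m) (s≤s k<m) =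
  trans (occ-++ (suc k) (map suc (reverserL m)) (cycleLeft m))
    (trans (cong₂ _+_ (trans (occ-map-suc k (reverserL m)) (occ-reverserL k m k<m)) (occ-cycleLeft (suc k) m k<m))
           (+-comm (suc k) 1))

occ-reverserR : ∀ k m → occ k (reverserR m) ≡ m ∸ suc k
occ-reverserR k zero = refl
occ-reverserR k (suc m) = begin
    occ k (reverserR m ++ cycleRight m)   ≡⟨ occ-++ k (reverserR m) (cycleRight m) ⟩
    occ k (reverserR m) + occ k (cycleRight m) ≡⟨ cong₂ _+_ (occ-reverserR k m) (occ-cycleRight k m) ⟩
    (m ∸ suc k) + ⟦ k < m ⟧               ≡⟨ count-step k m ⟩
    suc m ∸ suc k ∎
  where
    open ≡-Reasoning
    count-step : ∀ k m → (m ∸ suc k) + ⟦ k < m ⟧ ≡ m ∸ k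
    count-step k zero = sym (0∸n≡0 k)
    count-step zero (suc m) = +-comm m 1
    count-step (suc k) (suc m) = count-step k m

length-cycleLeft : ∀ m → length (cycleLeft m) ≡ m
length-cycleLeft zero = refl
length-cycleLeft (suc m) = cong suc (trans (length-map suc (cycleLeft m)) (length-cycleLeft m))

length-cycleRight : ∀ m → length (cycleRight m) ≡ m
length-cycleRight zero = refl
length-cycleRight (suc m) = trans (length-++ (map suc (cycleRight m)))
  (trans (cong (_+ 1) (trans (length-map suc (cycleRight m)) (length-cycleRight m))) (+-comm m 1))

length-reverserL : ∀ m → length (reverserL m) ≡ triangle m
length-reverserL zero = refl
length-reverserL (suc m) = trans (length-++ (map suc (reverserL m)))
  (trans (cong₂ _+_ (trans (length-map suc (reverserL m)) (length-reverserL m)) (length-cycleLeft m))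
         (+-comm (triangle m) m))

length-reverserR : ∀ m → length (reverserR m) ≡ triangle m
length-reverserR zero = refl
length-reverserR (suc m) = trans (length-++ (reverserR m))
  (trans (cong₂ _+_ (length-reverserR m) (length-cycleRight m)) (+-comm (triangle m) m))

prefix-id-idPerm : ∀ k n → k ≤ n → prefix id k (idPerm n) ≡ sum (countdown k)
prefix-id-idPerm k n k≤n = begin
    sum (map id (take k (upFrom 1 n)))  ≡⟨ cong sum (map-id (take k (upFrom 1 n))) ⟩
    sum (take k (upFrom 1 n))           ≡⟨ cong sum (take-upFrom 1 k n k≤n) ⟩
    sum (upFrom 1 k)                    ≡⟨ sum-↭ (↭-reverse (upFrom 1 k)) ⟨
    sum (longest k)                     ≡⟨ cong sum (longest≡countdown k) ⟩
    sum (countdown k) ∎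
  where open ≡-Reasoning

prefix-id-countdown : ∀ k d → prefix id k (countdown (k + d)) ≡ sum (countdown k) + k * d
prefix-id-countdown k d = begin
    sum (map id (take k (countdown (k + d))))  ≡⟨ cong sum (map-id (take k (countdown (k + d)))) ⟩
    sum (take k (countdown (k + d)))           ≡⟨ cong sum (take-countdown k d) ⟩
    sum (map (_+ d) (countdown k))             ≡⟨ sum-map-+ d (countdown k) ⟩
    sum (countdown k) + length (countdown k) * d ≡⟨ cong (λ l → sum (countdown k) + l * d) (length-countdown k) ⟩
    sum (countdown k) + k * d ∎
  where open ≡-Reasoning

atMost : ℕ → ℕ → ℕ
atMost k x = ⟦ x < suc k ⟧

prefix-atMost-idPerm : ∀ k n → k ≤ n → prefix (atMost k) k (idPerm n) ≡ k
prefix-atMost-idPerm k n k≤n = trans (cong (λ z → sum (map (atMost k) z)) (take-upFrom 1 k n k≤n)) (count-up 1 k ≤-refl)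
  where
    count-up : ∀ a m → a + m ≤ suc k → sum (map (atMost k) (upFrom a m)) ≡ m
    count-up a zero _ = refl
    count-up a (suc m) a+m<k = cong₂ _+_
      (⟦<⟧-true (≤-trans (s≤s (m≤m+n a m)) (≤-trans (≤-reflexive (sym (+-suc a m))) a+m<k)))
      (count-up (suc a) m (≤-trans (≤-reflexive (sym (+-suc a m))) a+m<k))

suc≤∸⇒+≤ : ∀ m n o → suc m ≤ o ∸ n → suc m + n ≤ o
suc≤∸⇒+≤ m zero o h = ≤-trans (≤-reflexive (+-identityʳ (suc m))) h
suc≤∸⇒+≤ m (suc n) (suc o) h = ≤-trans (≤-reflexive (+-suc (suc m) n)) (s≤s (suc≤∸⇒+≤ m n o h))

count-atMost-shifted : ∀ k d m → sum (map (atMost k) (map (_+ d) (countdown m))) ≡ m ⊓ (k ∸ d)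
count-atMost-shifted k d zero = refl
count-atMost-shifted k d (suc m) with suc m ≤? k ∸ d
... | yes m<k∸d = trans
    (cong₂ _+_ (⟦<⟧-true (s≤s (suc≤∸⇒+≤ m d k m<k∸d)))
               (trans (count-atMost-shifted k d m) (m≤n⇒m⊓n≡m (≤-trans (n≤1+n m) m<k∸d))))
    (sym (m≤n⇒m⊓n≡m m<k∸d))
... | no m≮k∸d = trans
    (cong₂ _+_ (⟦<⟧-false (≮⇒≥ (λ q → m≮k∸d (m+n≤o⇒m≤o∸n (suc m) {d} {k} (≤-pred q)))))
               (trans (count-atMost-shifted k d m) (m≥n⇒m⊓n≡n k∸d≤m)))
    (sym (m≥n⇒m⊓n≡n (m≤n⇒m≤1+n k∸d≤m)))
  where
    k∸d≤m : k ∸ d ≤ m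
    k∸d≤m = ≤-pred (≰⇒> m≮k∸d)

prefix-atMost-countdown : ∀ k d → prefix (atMost k) k (countdown (k + d)) ≡ k ∸ d
prefix-atMost-countdown k d = trans (cong (λ z → sum (map (atMost k) z)) (take-countdown k d))
  (trans (count-atMost-shifted k d k) (m≥n⇒m⊓n≡n (m∸n≤m k d)))

length-lower-bound : ∀ n t → eval n t ≡ longest n → triangle n + nonAscents (idPerm n) t ≤ length t
length-lower-bound n t t-w₀ = begin
    triangle n + nonAscents (idPerm n) t
  ≡⟨ cong (_+ nonAscents (idPerm n) t) (trans (sym (inv-countdown n)) (cong inv (sym (trans t-w₀ (longest≡countdown n))))) ⟩
    inv (eval n t) + nonAscents (idPerm n) t
  ≤⟨ inv-foldl (idPerm n) t ⟩
    inv (idPerm n) + length t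
  ≡⟨ cong (_+ length t) (inv-upFrom 1 n) ⟩
    length t ∎
  where open ≤-Reasoning

reduced-if-short : ∀ n s → IsWord n s → eval n s ≡ longest n → length s ≡ triangle n → IsReduced n (longest n) s
reduced-if-short n s s-word s-w₀ ∣s∣ = s-word , s-w₀ , λ t _ t-w₀ →
  ≤-trans (≤-reflexive ∣s∣) (≤-trans (m≤m+n (triangle n) _) (length-lower-bound n t t-w₀))

wordL wordR : ℕ → List ℕ
wordL n = map suc (reverserL n)
wordR n = map suc (reverserR n)

shifted-word : ∀ n s → All (λ j → suc j < n) s → IsWord n (map suc s)
shifted-word n s s<n = map⁺ (All.map (λ j<n → s≤s z≤n , j<n) s<n)

-- wordL and wordR evaluate to w₀ and have length n(n−1)/2, so they are reduced.
wordL-reduced : ∀ n → IsReduced n (longest n) (wordL n)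
wordL-reduced n = reduced-if-short n (wordL n) (shifted-word n _ (reverserL-bound n))
  (subst (λ m → foldl mulσ (idPerm n) (map suc (reverserL m)) ≡ longest n) (length-upFrom 1 n) (act-reverserL (idPerm n)))
  (trans (length-map suc (reverserL n)) (length-reverserL n))

wordR-reduced : ∀ n → IsReduced n (longest n) (wordR n)
wordR-reduced n = reduced-if-short n (wordR n) (shifted-word n _ (reverserR-bound n))
  (subst₂ (λ v m → foldl mulσ v (map suc (reverserR m)) ≡ longest n)
    (reverse-involutive (idPerm n)) (trans (length-reverse (idPerm n)) (length-upFrom 1 n))
    (act-reverserR (longest n)))
  (trans (length-map suc (reverserR n)) (length-reverserR n))

-- Every reduced word of w₀ has length n(n−1)/2, so all its letters swap ascents.
reduced-ascending : ∀ n s → IsReduced n (longest n) s → nonAscents (idPerm n) s ≡ 0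
reduced-ascending n s (_ , s-w₀ , s-min) = n≤0⇒n≡0 (+-cancelˡ-≤ (triangle n) _ 0 (begin
    triangle n + nonAscents (idPerm n) s  ≤⟨ length-lower-bound n s s-w₀ ⟩
    length s                              ≤⟨ s-min (wordL n) (proj₁ (wordL-reduced n)) (proj₁ (proj₂ (wordL-reduced n))) ⟩
    length (wordL n)                      ≡⟨ trans (length-map suc (reverserL n)) (length-reverserL n) ⟩
    triangle n                            ≡⟨ +-identityʳ (triangle n) ⟨
    triangle n + 0 ∎))
  where open ≤-Reasoning

positive : ∀ {n s} → IsWord n s → All (1 ≤_) s
positive = All.map proj₁

max-bound : ∀ n k → suc k < n → MaxKAtMost n (suc k) (longest n) (suc k * (n ∸ suc k))
max-bound n k k<n s s-red@(s-word , s-w₀ , _) = +-cancelˡ-≤ (sum (countdown (suc k))) _ _ (begin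
    sum (countdown (suc k)) + occ (suc k) s            ≡⟨ cong (_+ occ (suc k) s) (prefix-id-idPerm (suc k) n (<⇒≤ k<n)) ⟨
    prefix id (suc k) (idPerm n) + occ (suc k) s       ≤⟨ prefix-ascending k (idPerm n) s (positive s-word) (reduced-ascending n s s-red) ⟩
    prefix id (suc k) (eval n s)                       ≡⟨ cong (prefix id (suc k)) (trans s-w₀ (longest-split n (suc k) (<⇒≤ k<n))) ⟩
    prefix id (suc k) (countdown (suc k + d))          ≡⟨ prefix-id-countdown (suc k) d ⟩
    sum (countdown (suc k)) + suc k * d ∎)
  where
    open ≤-Reasoning
    d = n ∸ suc k

occ-lower-bound : ∀ n k → suc k < n → ∀ s → IsWord n s → eval n s ≡ longest n → suc k ⊓ (n ∸ suc k) ≤ occ (suc k) s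
occ-lower-bound n k k<n s s-word s-w₀ = subst (_≤ occ (suc k) s) (⊓-comm d (suc k))
  (+-cancelˡ-≤ (suc k ∸ d) (d ⊓ suc k) (occ (suc k) s) (begin
    (suc k ∸ d) + (d ⊓ suc k)                    ≡⟨ +-comm (suc k ∸ d) (d ⊓ suc k) ⟩
    (d ⊓ suc k) + (suc k ∸ d)                    ≡⟨ m⊓n+n∸m≡n d (suc k) ⟩
    suc k                                        ≡⟨ prefix-atMost-idPerm (suc k) n (<⇒≤ k<n) ⟨
    P (idPerm n)                                 ≤⟨ prefix-occ-bound (atMost (suc k)) (λ x → ⟦<⟧≤1 x (suc (suc k))) k (idPerm n) s (positive s-word) ⟩
    P (eval n s) + occ (suc k) s                 ≡⟨ cong (λ z → P z + occ (suc k) s) (trans s-w₀ (longest-split n (suc k) (<⇒≤ k<n))) ⟩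
    P (countdown (suc k + d)) + occ (suc k) s    ≡⟨ cong (_+ occ (suc k) s) (prefix-atMost-countdown (suc k) d) ⟩
    (suc k ∸ d) + occ (suc k) s ∎))
  where
    open ≤-Reasoning
    d = n ∸ suc k
    P = prefix (atMost (suc k)) (suc k)

min-attained : ∀ n k → suc k < n → Σ (List ℕ) λ s → IsReduced n (longest n) s × occ (suc k) s ≡ suc k ⊓ (n ∸ suc k)
min-attained n k k<n with suc k ≤? n ∸ suc k
... | yes k≤d = wordL n , wordL-reduced n ,
      trans (occ-map-suc k (reverserL n)) (trans (occ-reverserL k n k<n) (sym (m≤n⇒m⊓n≡m k≤d)))
... | no k≰d = wordR n , wordR-reduced n ,
      trans (occ-map-suc k (reverserR n)) (trans (occ-reverserR k n) (sym (m≥n⇒m⊓n≡n (<⇒≤ (≰⇒> k≰d)))))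

corollary4p4 : (n k : ℕ) → 3 ≤ n → 1 ≤ k → k ≤ n ∸ 1 →
    IsMinK n k (longest n) (k ⊓ (n ∸ k)) × MaxKAtMost n k (longest n) (k * (n ∸ k))
corollary4p4 zero _ () _ _
corollary4p4 (suc n) zero _ () _
corollary4p4 (suc n) (suc k) _ _ k≤n =
  (min-attained (suc n) k k<n , λ s (s-word , s-w₀ , _) → occ-lower-bound (suc n) k k<n s s-word s-w₀) ,
  max-bound (suc n) k k<n
  where
    k<n : suc k < suc n
    k<n = s≤s k≤n
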